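{- Let $G=(V,E)$ be a finite, undirected, loopless multi-graph and let $u\in V$. Then $$\tau(G)=\prod_{v\in V\setminus\{u\}}d_G(v)-\sum_{T\in \mathrm{NST}_u(G)}\ \prod_{v\in V\setminus V(T)}d_{G-V(T)}(v).$$
   Context: $\tau(G)$ denotes the number of spanning trees of $G$ (spanning trees are counted as edge sets, so trees using different parallel edges are distinct). $d_G(v)$ is the degree of $v$ in $G$, i.e. the number of edges of $G$ incident with $v$. $\mathrm{NST}_u(G)$ is the set of non-spanning subtrees of $G$ containing $u$, i.e. subgraphs $T$ of $G$ that are trees, with $u\in V(T)$ and $V(T)\neq V$ (this includes the single-vertex tree $\{u\}$; trees differing in the choice of parallel edges are distinct). For $S\subsetneq V$, $G-S$ denotes the subgraph of $G$ induced by $V\setminus S$, and $d_{G-V(T)}(v)$ is the degree of $v$ in $G-V(T)$. An empty product equals $1$. -}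

module Defs where

open import Data.Nat using (ℕ; zero; suc; _+_; _*_; _∸_)
import Data.Nat as ℕ
open import Data.Bool using (Bool; true; false; _∧_; _∨_; not; if_then_else_)
open import Data.Fin using (Fin)
open import Data.Fin.Properties using (_≟_)
open import Data.Fin.Subset using (Subset; ⁅_⁆; _∪_; ∣_∣; ⊥; ⊤)
open import Data.Vec using (Vec; []; _∷_; lookup; tabulate)
open import Data.List using (List; []; _∷_; map; _++_; allFin; foldr)
open import Data.Nat.ListAction using (sum; product)
open import Data.Product using (_×_; _,_; proj₁; proj₂)
open import Relation.Nullary.Decidable using (⌊_⌋)
open import Relation.Binary.PropositionalEquality using (_≢_)

-- A finite loopless multigraph on vertex set Fin n with edge set Fin m;
-- edge e joins proj₁ (ends e) and proj₂ (ends e).  Parallel edges are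
-- distinct indices e.
Loopless : {n m : ℕ} → (Fin m → Fin n × Fin n) → Set
Loopless ends = ∀ e → proj₁ (ends e) ≢ proj₂ (ends e)

_==_ : {n : ℕ} → Fin n → Fin n → Bool
v == w = ⌊ v ≟ w ⌋

anyFin : (k : ℕ) → (Fin k → Bool) → Bool
anyFin k p = foldr _∨_ false (map p (allFin k))

allFin? : (k : ℕ) → (Fin k → Bool) → Bool
allFin? k p = foldr _∧_ true (map p (allFin k))

sumFin : (k : ℕ) → (Fin k → ℕ) → ℕ
sumFin k f = sum (map f (allFin k))

prodFin : (k : ℕ) → (Fin k → ℕ) → ℕ
prodFin k f = product (map f (allFin k))

allSubsets : (k : ℕ) → List (Subset k)
allSubsets zero = [] ∷ []
allSubsets (suc k) = map (true ∷_) (allSubsets k) ++ map (false ∷_) (allSubsets k)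

sumSubsets : (k : ℕ) → (Subset k → ℕ) → ℕ
sumSubsets k f = sum (map f (allSubsets k))

module _ {n m : ℕ} (ends : Fin m → Fin n × Fin n) where

  src tgt : Fin m → Fin n
  src e = proj₁ (ends e)
  tgt e = proj₂ (ends e)

  incident : Fin m → Fin n → Bool
  incident e v = (src e == v) ∨ (tgt e == v)

  inside : Subset n → Fin m → Bool
  inside S e = lookup S (src e) ∧ lookup S (tgt e)

  degMinus : Subset n → Fin n → ℕ
  degMinus S v = sumFin m (λ e →
    if incident e v ∧ not (lookup S (src e)) ∧ not (lookup S (tgt e)) then 1 else 0)

  deg : Fin n → ℕ
  deg v = degMinus ⊥ v

  step : Subset m → Subset n → Subset n
  step F R = tabulate (λ w → lookup R w ∨ anyFin m (λ e → lookup F e ∧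
                 ((lookup R (src e) ∧ (tgt e == w)) ∨ (lookup R (tgt e) ∧ (src e == w)))))

  iter : ℕ → Subset m → Subset n → Subset n
  iter zero F R = R
  iter (suc k) F R = step F (iter k F R)

  -- vertices reachable from v in the graph (V, F)  (walks have length < n)
  reach : Subset m → Fin n → Subset n
  reach F v = iter n F ⁅ v ⁆

  isSubgraph : Subset n → Subset m → Bool
  isSubgraph S F = allFin? m (λ e → not (lookup F e) ∨ inside S e)

  connected : Subset n → Subset m → Bool
  connected S F = allFin? n (λ v → allFin? n (λ w →
    not (lookup S v) ∨ not (lookup S w) ∨ lookup (reach F v) w))

  isTree : Subset n → Subset m → Bool
  isTree S F = isSubgraph S F ∧ connected S F ∧ ⌊ ∣ F ∣ ℕ.≟ ∣ S ∣ ∸ 1 ⌋ ∧ ⌊ 1 ℕ.≤? ∣ S ∣ ⌋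

  τ : ℕ
  τ = sumSubsets m (λ F → if isTree ⊤ F then 1 else 0)

  prodDegExcept : Fin n → ℕ
  prodDegExcept u = prodFin n (λ v → if v == u then 1 else deg v)

  prodDegOutside : Subset n → ℕ
  prodDegOutside S = prodFin n (λ v → if lookup S v then 1 else degMinus S v)

  proper : Subset n → Bool
  proper S = not (allFin? n (λ v → lookup S v))

  -- ∑_{T ∈ NST_u(G)} ∏_{v ∈ V \ V(T)} d_{G - V(T)}(v),
  -- where T ranges over pairs (V(T), E(T)) = (S, F) forming a tree subgraph
  -- with u ∈ S and S ≠ V.
  sumNST : Fin n → ℕ
  sumNST u = sumSubsets n (λ S → sumSubsets m (λ F →
    if isTree S F ∧ lookup S u ∧ proper S then prodDegOutside S else 0))

{-# OPTIONS --safe #-}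
module Submission where

-- Expanding the product of the degrees d(v), v ≠ u, counts the choice functions giving every
-- vertex v ≠ u an incident edge (and u nothing). Follow the chosen edges from each vertex: the
-- vertices whose route reaches u form the basin B, the edges chosen inside B form an arborescence
-- rooted at u, hence a tree T ∋ u with V(T) = B, and every vertex outside B has chosen an edge of
-- G − B, as otherwise its route would enter B. Conversely a tree T ∋ u has exactly one orientation
-- towards u, and any choice of edges of G − V(T) at the vertices outside T completes it. So the
-- product equals the sum over all trees T ∋ u of ∏_{v ∉ V(T)} d_{G−V(T)}(v); the spanning trees
-- contribute τ(G), each with the empty product 1, and the remaining trees give the NST sum.

open import Defs
open import Data.Bool using (Bool; true; false; _∧_; _∨_; not; if_then_else_)
import Data.Bool as Bool
open import Data.Bool.Properties using (not-injective; ∨-zeroʳ; ∧-zeroʳ; ∧-identityʳ; ∧-conicalˡ; ∧-conicalʳ)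
open import Data.Empty using (⊥-elim)
open import Data.Fin using (Fin; zero; suc; toℕ)
open import Data.Fin.Properties using (_≟_; suc-injective; pigeonhole; toℕ<n)
open import Data.Fin.Subset using (Subset; ⁅_⁆; ∣_∣; _∈_; _∉_; _⊆_; ⊥; ⊤)
open import Data.Fin.Subset.Properties using (p⊂q⇒∣p∣<∣q∣; ∣p∣≤n; ∣⁅x⁆∣≡1; x∈⁅x⁆; x∈⁅y⁆⇒x≡y)
open import Data.List using (List; []; _∷_; map; _++_; allFin; foldr; cartesianProductWith)
open import Data.List.Properties using (map-++; map-∘; map-cong; map-tabulate)
open import Data.Maybe using (Maybe; just; nothing; maybe′)
import Data.Maybe as Maybe
open import Data.Maybe.Properties using (just-injective)
import Data.Maybe.Properties as MaybeP
import Data.Nat as ℕ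
open import Data.Nat using (ℕ; zero; suc; _+_; _*_; _∸_; _≤_; _<_; z≤n; s≤s; _≤?_)
open import Data.Nat.Induction using (<-rec)
open import Data.Nat.ListAction using (sum; product)
open import Data.Nat.ListAction.Properties using (sum-++)
open import Data.Nat.Properties
  using ( +-identityʳ; *-zeroʳ; *-distribˡ-+; *-comm; m+[n∸m]≡n; m+n∸n≡m; m≤n+m; +-monoˡ-<
        ; n≤0⇒n≡0; n<1+n; ≤-pred; ≤-refl; ≤-trans; ≤-<-trans; <-irrefl; <⇒≤; ≰⇒> )
open import Algebra.Properties.CommutativeSemigroup Data.Nat.Properties.+-commutativeSemigroup using (interchange)
open import Data.Product using (∃; _×_; _,_; proj₁; proj₂; uncurry)
open import Data.Sum using (_⊎_; inj₁; inj₂)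
import Data.Sum as Sum
open import Data.Vec using (Vec; []; _∷_; lookup; tabulate)
open import Data.Vec.Properties
  using (≡-dec; []=⇒lookup; lookup⇒[]=; lookup∘tabulate; lookup-replicate; tabulate∘lookup; tabulate-cong)
open import Function using (_∘_; id; case_of_)
open import Relation.Binary.PropositionalEquality
open import Relation.Nullary using (Dec; does; yes; no; ¬_)
open import Relation.Nullary.Decidable using (⌊_⌋; dec-true; dec-false; isYes≗does)

sumOver : {A : Set} → List A → (A → ℕ) → ℕ
sumOver xs f = sum (map f xs)

module _ {A : Set} where

  sumOver-cong : (xs : List A) {f g : A → ℕ} → (∀ x → f x ≡ g x) → sumOver xs f ≡ sumOver xs g
  sumOver-cong xs f≗g = cong sum (map-cong f≗g xs)

  sumOver-++ : (xs ys : List A) (f : A → ℕ) → sumOver (xs ++ ys) f ≡ sumOver xs f + sumOver ys f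
  sumOver-++ xs ys f = trans (cong sum (map-++ f xs ys)) (sum-++ (map f xs) (map f ys))

  sumOver-map : {B : Set} (xs : List B) (g : B → A) (f : A → ℕ) → sumOver (map g xs) f ≡ sumOver xs (f ∘ g)
  sumOver-map xs g f = cong sum (sym (map-∘ xs))

  sumOver-zero : (xs : List A) {f : A → ℕ} → (∀ x → f x ≡ 0) → sumOver xs f ≡ 0
  sumOver-zero [] f≗0 = refl
  sumOver-zero (x ∷ xs) f≗0 = cong₂ _+_ (f≗0 x) (sumOver-zero xs f≗0)

  sumOver-+ : (xs : List A) (f g : A → ℕ) → sumOver xs (λ x → f x + g x) ≡ sumOver xs f + sumOver xs g
  sumOver-+ [] f g = refl
  sumOver-+ (x ∷ xs) f g = trans (cong (f x + g x +_) (sumOver-+ xs f g)) (interchange (f x) (g x) _ _)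

  *-distribˡ-sumOver : (c : ℕ) (xs : List A) (f : A → ℕ) → c * sumOver xs f ≡ sumOver xs (λ x → c * f x)
  *-distribˡ-sumOver c [] f = *-zeroʳ c
  *-distribˡ-sumOver c (x ∷ xs) f = trans (*-distribˡ-+ c (f x) _) (cong (c * f x +_) (*-distribˡ-sumOver c xs f))

  *-distribʳ-sumOver : (c : ℕ) (xs : List A) (f : A → ℕ) → sumOver xs f * c ≡ sumOver xs (λ x → f x * c)
  *-distribʳ-sumOver c xs f = trans (*-comm _ c) (trans (*-distribˡ-sumOver c xs f) (sumOver-cong xs (λ x → *-comm c (f x))))

sumOver-comm : {A B : Set} (xs : List A) (ys : List B) (g : A → B → ℕ) →
  sumOver xs (λ x → sumOver ys (g x)) ≡ sumOver ys (λ y → sumOver xs (λ x → g x y))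
sumOver-comm [] ys g = sym (sumOver-zero ys (λ _ → refl))
sumOver-comm (x ∷ xs) ys g = trans (cong (sumOver ys (g x) +_) (sumOver-comm xs ys g)) (sym (sumOver-+ ys (g x) _))

foldr-map-allFin-suc : {A B : Set} (c : A → B → B) (z : B) (k : ℕ) (f : Fin (suc k) → A) →
  foldr c z (map f (allFin (suc k))) ≡ c (f zero) (foldr c z (map (f ∘ suc) (allFin k)))
foldr-map-allFin-suc c z k f =
  cong (λ l → c (f zero) (foldr c z l)) (trans (map-tabulate {n = k} suc f) (sym (map-tabulate {n = k} id (f ∘ suc))))

module _ (k : ℕ) where

  sumFin-suc : (f : Fin (suc k) → ℕ) → sumFin (suc k) f ≡ f zero + sumFin k (f ∘ suc)
  sumFin-suc = foldr-map-allFin-suc _+_ 0 k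

  prodFin-suc : (f : Fin (suc k) → ℕ) → prodFin (suc k) f ≡ f zero * prodFin k (f ∘ suc)
  prodFin-suc = foldr-map-allFin-suc _*_ 1 k

  anyFin-suc : (p : Fin (suc k) → Bool) → anyFin (suc k) p ≡ (p zero ∨ anyFin k (p ∘ suc))
  anyFin-suc = foldr-map-allFin-suc _∨_ false k

  allFin?-suc : (p : Fin (suc k) → Bool) → allFin? (suc k) p ≡ (p zero ∧ allFin? k (p ∘ suc))
  allFin?-suc = foldr-map-allFin-suc _∧_ true k

  prodFin-cong : {f g : Fin k → ℕ} → (∀ i → f i ≡ g i) → prodFin k f ≡ prodFin k g
  prodFin-cong f≗g = cong product (map-cong f≗g (allFin k))

  anyFin-cong : {p q : Fin k → Bool} → (∀ i → p i ≡ q i) → anyFin k p ≡ anyFin k q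
  anyFin-cong p≗q = cong (foldr _∨_ false) (map-cong p≗q (allFin k))

anyFin-intro : (k : ℕ) (p : Fin k → Bool) (i : Fin k) → p i ≡ true → anyFin k p ≡ true
anyFin-intro (suc k) p zero pi rewrite anyFin-suc k p | pi = refl
anyFin-intro (suc k) p (suc i) pi rewrite anyFin-suc k p | anyFin-intro k (p ∘ suc) i pi = ∨-zeroʳ (p zero)

anyFin-elim : (k : ℕ) (p : Fin k → Bool) → anyFin k p ≡ true → ∃ λ i → p i ≡ true
anyFin-elim (suc k) p h rewrite anyFin-suc k p with p zero in p0
... | true = zero , p0
... | false with anyFin-elim k (p ∘ suc) h
... | i , pi = suc i , pi

allFin?-intro : (k : ℕ) (p : Fin k → Bool) → (∀ i → p i ≡ true) → allFin? k p ≡ true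
allFin?-intro zero p all = refl
allFin?-intro (suc k) p all rewrite allFin?-suc k p | all zero = allFin?-intro k (p ∘ suc) (all ∘ suc)

allFin?-elim : (k : ℕ) (p : Fin k → Bool) → allFin? k p ≡ true → ∀ i → p i ≡ true
allFin?-elim (suc k) p h i rewrite allFin?-suc k p with p zero in p0
allFin?-elim (suc k) p h zero    | true = p0
allFin?-elim (suc k) p h (suc i) | true = allFin?-elim k (p ∘ suc) h i

≡-from-true⇔ : {a b : Bool} → (a ≡ true → b ≡ true) → (b ≡ true → a ≡ true) → a ≡ b
≡-from-true⇔ {true}  a⇒b _ = sym (a⇒b refl)
≡-from-true⇔ {false} {true} _ b⇒a = b⇒a refl
≡-from-true⇔ {false} {false} _ _ = refl

≢true⇒≡false : {b : Bool} → ¬ (b ≡ true) → b ≡ false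
≢true⇒≡false {true} b≢true = ⊥-elim (b≢true refl)
≢true⇒≡false {false} _ = refl

∧≡true : (a b : Bool) → (a ∧ b) ≡ true → a ≡ true × b ≡ true
∧≡true a b a∧b = ∧-conicalˡ a b a∧b , ∧-conicalʳ a b a∧b

∨≡true : (a b : Bool) → (a ∨ b) ≡ true → a ≡ true ⊎ b ≡ true
∨≡true true b _ = inj₁ refl
∨≡true false b b≡true = inj₂ b≡true

true⇒witness : {P : Set} (P? : Dec P) → ⌊ P? ⌋ ≡ true → P
true⇒witness (yes p) _ = p

does⇒witness : {P : Set} (P? : Dec P) → does P? ≡ true → P
does⇒witness (yes p) _ = p

witness⇒true : {P : Set} (P? : Dec P) → P → ⌊ P? ⌋ ≡ true
witness⇒true P? p = trans (isYes≗does P?) (dec-true P? p)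

==⇒≡ : {k : ℕ} {v w : Fin k} → (v == w) ≡ true → v ≡ w
==⇒≡ {v = v} {w} = true⇒witness (v ≟ w)

≡⇒== : {k : ℕ} {v w : Fin k} → v ≡ w → (v == w) ≡ true
≡⇒== {v = v} {w} = witness⇒true (v ≟ w)

≢⇒== : {k : ℕ} {v w : Fin k} → ¬ (v ≡ w) → (v == w) ≡ false
≢⇒== {v = v} {w} v≢w = trans (isYes≗does (v ≟ w)) (dec-false (v ≟ w) v≢w)

==-refl : {k : ℕ} (v : Fin k) → (v == v) ≡ true
==-refl v = ≡⇒== refl

==-sym : {k : ℕ} (v w : Fin k) → (v == w) ≡ (w == v)
==-sym v w = ≡-from-true⇔ (≡⇒== ∘ sym ∘ ==⇒≡) (≡⇒== ∘ sym ∘ ==⇒≡)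

⟦_⟧ : Bool → ℕ
⟦ b ⟧ = if b then 1 else 0

⟦∧⟧ : (a b : Bool) → ⟦ a ⟧ * ⟦ b ⟧ ≡ ⟦ a ∧ b ⟧
⟦∧⟧ true b = +-identityʳ ⟦ b ⟧
⟦∧⟧ false b = refl

prodFin-⟦⟧ : (k : ℕ) (p : Fin k → Bool) → prodFin k (⟦_⟧ ∘ p) ≡ ⟦ allFin? k p ⟧
prodFin-⟦⟧ zero p = refl
prodFin-⟦⟧ (suc k) p = begin
  prodFin (suc k) (⟦_⟧ ∘ p)             ≡⟨ prodFin-suc k (⟦_⟧ ∘ p) ⟩
  ⟦ p zero ⟧ * prodFin k (⟦_⟧ ∘ p ∘ suc)  ≡⟨ cong (⟦ p zero ⟧ *_) (prodFin-⟦⟧ k (p ∘ suc)) ⟩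
  ⟦ p zero ⟧ * ⟦ allFin? k (p ∘ suc) ⟧    ≡⟨ ⟦∧⟧ (p zero) _ ⟩
  ⟦ p zero ∧ allFin? k (p ∘ suc) ⟧        ≡⟨ cong ⟦_⟧ (sym (allFin?-suc k p)) ⟩
  ⟦ allFin? (suc k) p ⟧                   ∎
  where open ≡-Reasoning

sumFin-⟦⟧-unique : (k : ℕ) (p : Fin k → Bool) → (∀ i j → p i ≡ true → p j ≡ true → i ≡ j) →
  sumFin k (⟦_⟧ ∘ p) ≡ ⟦ anyFin k p ⟧
sumFin-⟦⟧-unique zero p unique = refl
sumFin-⟦⟧-unique (suc k) p unique rewrite sumFin-suc k (⟦_⟧ ∘ p) | anyFin-suc k p with p zero in p0
... | true = cong suc (sumOver-zero (allFin k) rest-false)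
  where
  rest-false : ∀ i → ⟦ p (suc i) ⟧ ≡ 0
  rest-false i with p (suc i) in pi
  ... | true with () ← unique zero (suc i) p0 pi
  ... | false = refl
... | false = sumFin-⟦⟧-unique k (p ∘ suc) (λ i j pi pj → suc-injective (unique (suc i) (suc j) pi pj))

sumFin-δ : (k : ℕ) (j : Fin k) → sumFin k (λ i → ⟦ i == j ⟧) ≡ 1
sumFin-δ k j =
  trans (sumFin-⟦⟧-unique k (_== j) (λ i i′ i=j i′=j → trans (==⇒≡ i=j) (sym (==⇒≡ i′=j))))
        (cong ⟦_⟧ (anyFin-intro k (_== j) j (==-refl j)))

sumFin-δ′ : (k : ℕ) (j : Fin k) → sumFin k (λ i → ⟦ j == i ⟧) ≡ 1
sumFin-δ′ k j = trans (sumOver-cong (allFin k) (λ i → cong ⟦_⟧ (==-sym j i))) (sumFin-δ k j)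

∣p∣≡sumFin : {k : ℕ} (p : Subset k) → ∣ p ∣ ≡ sumFin k (λ i → ⟦ lookup p i ⟧)
∣p∣≡sumFin [] = refl
∣p∣≡sumFin {suc k} (true ∷ p) = trans (cong suc (∣p∣≡sumFin p)) (sym (sumFin-suc k (λ i → ⟦ lookup (true ∷ p) i ⟧)))
∣p∣≡sumFin {suc k} (false ∷ p) = trans (∣p∣≡sumFin p) (sym (sumFin-suc k (λ i → ⟦ lookup (false ∷ p) i ⟧)))

lookup-ext : {A : Set} {k : ℕ} {xs ys : Vec A k} → (∀ i → lookup xs i ≡ lookup ys i) → xs ≡ ys
lookup-ext {xs = xs} {ys} same = trans (sym (tabulate∘lookup xs)) (trans (tabulate-cong same) (tabulate∘lookup ys))

∈⇒lookup : {k : ℕ} {p : Subset k} {x : Fin k} → x ∈ p → lookup p x ≡ true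
∈⇒lookup = []=⇒lookup

lookup⇒∈ : {k : ℕ} {p : Subset k} {x : Fin k} → lookup p x ≡ true → x ∈ p
lookup⇒∈ {p = p} {x} = lookup⇒[]= x p

false⇒∉ : {k : ℕ} {p : Subset k} {x : Fin k} → lookup p x ≡ false → x ∉ p
false⇒∉ x∉p x∈p with () ← trans (sym x∉p) (∈⇒lookup x∈p)

⊆∧∣∣≡⇒≡ : {k : ℕ} {p q : Subset k} → p ⊆ q → ∣ p ∣ ≡ ∣ q ∣ → p ≡ q
⊆∧∣∣≡⇒≡ {p = p} {q} p⊆q same = lookup-ext pointwise
  where
  pointwise : ∀ i → lookup p i ≡ lookup q i
  pointwise i with lookup p i in pi | lookup q i in qi
  ... | true  | true  = refl
  ... | false | false = refl
  ... | true  | false = sym (trans (sym qi) (∈⇒lookup (p⊆q (lookup⇒∈ pi))))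
  ... | false | true  = ⊥-elim (<-irrefl same (p⊂q⇒∣p∣<∣q∣ (p⊆q , i , lookup⇒∈ qi , false⇒∉ pi)))

-- Subsets are compared with `does` rather than ⌊_⌋: `does` computes through the map′ inside
-- ≡-dec, so that the cases of sumOver-allSubsets-δ below reduce by definition.
_≟ˢ_ : {k : ℕ} (S X : Subset k) → Dec (S ≡ X)
_≟ˢ_ = ≡-dec Bool._≟_

sumOver-allSubsets-δ : (k : ℕ) (X : Subset k) (h : Subset k → ℕ) →
  sumOver (allSubsets k) (λ S → ⟦ does (S ≟ˢ X) ⟧ * h S) ≡ h X
sumOver-allSubsets-δ zero [] h = trans (+-identityʳ _) (+-identityʳ (h []))
sumOver-allSubsets-δ (suc k) (x ∷ X) h = begin
  sumOver (map (true ∷_) (allSubsets k) ++ map (false ∷_) (allSubsets k)) δh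
    ≡⟨ sumOver-++ (map (true ∷_) (allSubsets k)) _ δh ⟩
  sumOver (map (true ∷_) (allSubsets k)) δh + sumOver (map (false ∷_) (allSubsets k)) δh
    ≡⟨ cong₂ _+_ (sumOver-map (allSubsets k) (true ∷_) δh) (sumOver-map (allSubsets k) (false ∷_) δh) ⟩
  sumOver (allSubsets k) (δh ∘ (true ∷_)) + sumOver (allSubsets k) (δh ∘ (false ∷_))
    ≡⟨ split x ⟩
  h (x ∷ X) ∎
  where
  open ≡-Reasoning
  δh : Subset (suc k) → ℕ
  δh S = ⟦ does (S ≟ˢ (x ∷ X)) ⟧ * h S
  split : ∀ x → sumOver (allSubsets k) (λ S → ⟦ does ((true ∷ S) ≟ˢ (x ∷ X)) ⟧ * h (true ∷ S))
              + sumOver (allSubsets k) (λ S → ⟦ does ((false ∷ S) ≟ˢ (x ∷ X)) ⟧ * h (false ∷ S)) ≡ h (x ∷ X)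
  split true = trans (cong₂ _+_ (sumOver-allSubsets-δ k X (h ∘ (true ∷_))) (sumOver-zero (allSubsets k) (λ _ → refl)))
                     (+-identityʳ _)
  split false = cong₂ _+_ (sumOver-zero (allSubsets k) (λ _ → refl)) (sumOver-allSubsets-δ k X (h ∘ (false ∷_)))

allVecs : {A : Set} → List A → (k : ℕ) → List (Vec A k)
allVecs xs zero = [] ∷ []
allVecs xs (suc k) = cartesianProductWith _∷_ xs (allVecs xs k)

sumOver-cartesianProductWith : {A B C : Set} (_∙_ : A → B → C) (xs : List A) (ys : List B) (f : C → ℕ) →
  sumOver (cartesianProductWith _∙_ xs ys) f ≡ sumOver xs (λ x → sumOver ys (λ y → f (x ∙ y)))
sumOver-cartesianProductWith _∙_ [] ys f = refl
sumOver-cartesianProductWith _∙_ (x ∷ xs) ys f =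
  trans (sumOver-++ (map (x ∙_) ys) _ f) (cong₂ _+_ (sumOver-map ys (x ∙_) f) (sumOver-cartesianProductWith _∙_ xs ys f))

prodFin-sumOver : {A : Set} (xs : List A) (k : ℕ) (c : Fin k → A → ℕ) →
  prodFin k (λ i → sumOver xs (c i)) ≡ sumOver (allVecs xs k) (λ v → prodFin k (λ i → c i (lookup v i)))
prodFin-sumOver xs zero c = refl
prodFin-sumOver xs (suc k) c = begin
  prodFin (suc k) (λ i → sumOver xs (c i))
    ≡⟨ prodFin-suc k (λ i → sumOver xs (c i)) ⟩
  sumOver xs (c zero) * prodFin k (λ i → sumOver xs (c (suc i)))
    ≡⟨ cong (sumOver xs (c zero) *_) (prodFin-sumOver xs k (c ∘ suc)) ⟩
  sumOver xs (c zero) * sumOver (allVecs xs k) (λ v → prodFin k (λ i → c (suc i) (lookup v i)))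
    ≡⟨ *-distribʳ-sumOver _ xs (c zero) ⟩
  sumOver xs (λ x → c zero x * sumOver (allVecs xs k) (λ v → prodFin k (λ i → c (suc i) (lookup v i))))
    ≡⟨ sumOver-cong xs (λ x → *-distribˡ-sumOver (c zero x) (allVecs xs k) _) ⟩
  sumOver xs (λ x → sumOver (allVecs xs k) (λ v → c zero x * prodFin k (λ i → c (suc i) (lookup v i))))
    ≡⟨ sumOver-cong xs (λ x → sumOver-cong (allVecs xs k) (λ v → sym (prodFin-suc k (λ i → c i (lookup (x ∷ v) i))))) ⟩
  sumOver xs (λ x → sumOver (allVecs xs k) (λ v → prodFin (suc k) (λ i → c i (lookup (x ∷ v) i))))
    ≡⟨ sym (sumOver-cartesianProductWith _∷_ xs (allVecs xs k) _) ⟩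
  sumOver (allVecs xs (suc k)) (λ v → prodFin (suc k) (λ i → c i (lookup v i))) ∎
  where open ≡-Reasoning

applyN : {A : Set} → (A → A) → ℕ → A → A
applyN g zero x = x
applyN g (suc k) x = applyN g k (g x)

module _ {A : Set} (g : A → A) where

  applyN-+ : ∀ a b x → applyN g (a + b) x ≡ applyN g b (applyN g a x)
  applyN-+ zero b x = refl
  applyN-+ (suc a) b x = applyN-+ a b (g x)

  applyN-fixed : ∀ k {x} → g x ≡ x → applyN g k x ≡ x
  applyN-fixed zero gx = refl
  applyN-fixed (suc k) gx rewrite gx = applyN-fixed k gx

  applyN-suc : ∀ k x → applyN g (suc k) x ≡ g (applyN g k x)
  applyN-suc zero x = refl
  applyN-suc (suc k) x = applyN-suc k (g x)

applyN-2-cycle : {A : Set} (g : A → A) {v w : A} → g v ≡ w → g w ≡ v → ∀ k → applyN g k v ≡ v ⊎ applyN g k v ≡ w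
applyN-2-cycle g gv gw zero = inj₁ refl
applyN-2-cycle g gv gw (suc k) rewrite gv = Sum.swap (applyN-2-cycle g gw gv k)

-- A shortest route to the fixed point u visits no vertex twice, so it has at most n steps.
applyN-within : {n : ℕ} (g : Fin n → Fin n) {u : Fin n} → g u ≡ u →
  ∀ k v → applyN g k v ≡ u → applyN g n v ≡ u
applyN-within {n} g {u} gu k v = <-rec (λ k → applyN g k v ≡ u → applyN g n v ≡ u) shorten k
  where
  shorten : ∀ k → (∀ {j} → j < k → applyN g j v ≡ u → applyN g n v ≡ u) → applyN g k v ≡ u → applyN g n v ≡ u
  shorten k shorter reached with k ≤? n
  ... | yes k≤n = begin
    applyN g n v                        ≡⟨ cong (λ j → applyN g j v) (sym (m+[n∸m]≡n k≤n)) ⟩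
    applyN g (k + (n ∸ k)) v            ≡⟨ applyN-+ g k (n ∸ k) v ⟩
    applyN g (n ∸ k) (applyN g k v)     ≡⟨ cong (applyN g (n ∸ k)) reached ⟩
    applyN g (n ∸ k) u                  ≡⟨ applyN-fixed g (n ∸ k) gu ⟩
    u                                   ∎
    where open ≡-Reasoning
  ... | no k≰n with i , j , i<j , same ← pigeonhole (n<1+n n) (λ i → applyN g (toℕ i) v) =
    shorter (subst (toℕ i + (k ∸ toℕ j) <_) (m+[n∸m]≡n j≤k) (+-monoˡ-< (k ∸ toℕ j) i<j)) (begin
      applyN g (toℕ i + (k ∸ toℕ j)) v           ≡⟨ applyN-+ g (toℕ i) (k ∸ toℕ j) v ⟩
      applyN g (k ∸ toℕ j) (applyN g (toℕ i) v)  ≡⟨ cong (applyN g (k ∸ toℕ j)) same ⟩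
      applyN g (k ∸ toℕ j) (applyN g (toℕ j) v)  ≡⟨ sym (applyN-+ g (toℕ j) (k ∸ toℕ j) v) ⟩
      applyN g (toℕ j + (k ∸ toℕ j)) v           ≡⟨ cong (λ l → applyN g l v) (m+[n∸m]≡n j≤k) ⟩
      applyN g k v                               ≡⟨ reached ⟩
      u                                          ∎)
    where
    open ≡-Reasoning
    j≤k : toℕ j ≤ k
    j≤k = ≤-trans (≤-pred (toℕ<n j)) (<⇒≤ (≰⇒> k≰n))

find : (k : ℕ) → (Fin k → Bool) → Maybe (Fin k)
find zero p = nothing
find (suc k) p = if p zero then just zero else Maybe.map suc (find k (p ∘ suc))

find-sound : ∀ k (p : Fin k → Bool) {i} → find k p ≡ just i → p i ≡ true
find-sound (suc k) p found with p zero in p0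
find-sound (suc k) p refl | true = p0
... | false with find k (p ∘ suc) in found′
find-sound (suc k) p refl | false | just j = find-sound k (p ∘ suc) found′
find-sound (suc k) p ()   | false | nothing

find-complete : ∀ k (p : Fin k → Bool) j → p j ≡ true → ∃ λ i → find k p ≡ just i
find-complete (suc k) p j pj with p zero in p0
... | true = zero , refl
find-complete (suc k) p zero pj | false with () ← trans (sym p0) pj
find-complete (suc k) p (suc j) pj | false with i , found ← find-complete k (p ∘ suc) j pj =
  suc i , cong (Maybe.map suc) found

least : (ℕ → Bool) → ℕ → ℕ
least p zero = zero
least p (suc b) = if p zero then zero else suc (least (p ∘ suc) b)

least≤ : ∀ (p : ℕ → Bool) b j → p j ≡ true → least p b ≤ j
least≤ p zero j pj = z≤n
least≤ p (suc b) j pj with p zero in p0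
... | true = z≤n
least≤ p (suc b) zero pj | false with () ← trans (sym p0) pj
least≤ p (suc b) (suc j) pj | false = s≤s (least≤ (p ∘ suc) b j pj)

least-sound : ∀ (p : ℕ → Bool) b j → j < b → p j ≡ true → p (least p b) ≡ true
least-sound p zero j () pj
least-sound p (suc b) j j<b pj with p zero in p0
... | true = p0
least-sound p (suc b) zero j<b pj | false with () ← trans (sym p0) pj
least-sound p (suc b) (suc j) (s≤s j<b) pj | false = least-sound (p ∘ suc) b j j<b pj

module _ {n m : ℕ} (ends : Fin m → Fin n × Fin n) where

  private
    s t : Fin m → Fin n
    s = src ends
    t = tgt ends

  other : Fin m → Fin n → Fin n
  other e v = if s e == v then t e else s e

  incident-src : ∀ e {w} → s e ≡ w → incident ends e w ≡ true
  incident-src e refl rewrite ==-refl (s e) = refl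

  incident-tgt : ∀ e {w} → t e ≡ w → incident ends e w ≡ true
  incident-tgt e refl rewrite ==-refl (t e) = ∨-zeroʳ _

  incident-elim : ∀ e w → incident ends e w ≡ true → s e ≡ w ⊎ t e ≡ w
  incident-elim e w e∋w with s e == w in se=w
  ... | true  = inj₁ (==⇒≡ se=w)
  ... | false = inj₂ (==⇒≡ e∋w)

  incident-other : ∀ e v → incident ends e v ≡ true →
    (s e ≡ v × t e ≡ other e v) ⊎ (t e ≡ v × s e ≡ other e v)
  incident-other e v e∋v with s e == v in se=v
  ... | true  = inj₁ (==⇒≡ se=v , refl)
  ... | false = inj₂ (==⇒≡ e∋v , refl)

  other-incident : ∀ e v → incident ends e v ≡ true → incident ends e (other e v) ≡ true
  other-incident e v e∋v with incident-other e v e∋v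
  ... | inj₁ (_ , t≡o) = incident-tgt e t≡o
  ... | inj₂ (_ , s≡o) = incident-src e s≡o

  incident-endpoints : ∀ e v w → incident ends e v ≡ true → incident ends e w ≡ true → w ≡ v ⊎ w ≡ other e v
  incident-endpoints e v w e∋v e∋w with incident-other e v e∋v | incident-elim e w e∋w
  ... | inj₁ (s≡v , _)   | inj₁ s≡w = inj₁ (trans (sym s≡w) s≡v)
  ... | inj₁ (_ , t≡o)   | inj₂ t≡w = inj₂ (trans (sym t≡w) t≡o)
  ... | inj₂ (_ , s≡o)   | inj₁ s≡w = inj₂ (trans (sym s≡w) s≡o)
  ... | inj₂ (t≡v , _)   | inj₂ t≡w = inj₁ (trans (sym t≡w) t≡v)

  other-endpoint : ∀ e {v x} → incident ends e v ≡ true → incident ends e x ≡ true → x ≢ v → other e v ≡ x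
  other-endpoint e {v} {x} e∋v e∋x x≢v with incident-endpoints e v x e∋v e∋x
  ... | inj₁ x≡v = ⊥-elim (x≢v x≡v)
  ... | inj₂ x≡o = sym x≡o

  endpoints-in : ∀ (S : Subset n) e v → incident ends e v ≡ true →
    lookup S v ≡ true → lookup S (other e v) ≡ true → lookup S (s e) ≡ true × lookup S (t e) ≡ true
  endpoints-in S e v e∋v v∈S o∈S with incident-other e v e∋v
  ... | inj₁ (s≡v , t≡o) = subst (λ x → lookup S x ≡ true) (sym s≡v) v∈S , subst (λ x → lookup S x ≡ true) (sym t≡o) o∈S
  ... | inj₂ (t≡v , s≡o) = subst (λ x → lookup S x ≡ true) (sym s≡o) o∈S , subst (λ x → lookup S x ≡ true) (sym t≡v) v∈S

  enters : Subset m → Subset n → Fin n → Fin m → Bool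
  enters F R w e = lookup F e ∧ ((lookup R (s e) ∧ (t e == w)) ∨ (lookup R (t e) ∧ (s e == w)))

  step-lookup : ∀ F R w → lookup (step ends F R) w ≡ (lookup R w ∨ anyFin m (enters F R w))
  step-lookup F R w = lookup∘tabulate _ w

  step-⊇ : ∀ F R w → lookup R w ≡ true → lookup (step ends F R) w ≡ true
  step-⊇ F R w w∈R rewrite step-lookup F R w | w∈R = refl

  step-src→tgt : ∀ F R e → lookup F e ≡ true → lookup R (s e) ≡ true → lookup (step ends F R) (t e) ≡ true
  step-src→tgt F R e e∈F s∈R rewrite step-lookup F R (t e) =
    trans (cong (lookup R (t e) ∨_) (anyFin-intro m _ e found)) (∨-zeroʳ _)
    where
    found : enters F R (t e) e ≡ true
    found rewrite e∈F | s∈R | ==-refl (t e) = refl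

  step-tgt→src : ∀ F R e → lookup F e ≡ true → lookup R (t e) ≡ true → lookup (step ends F R) (s e) ≡ true
  step-tgt→src F R e e∈F t∈R rewrite step-lookup F R (s e) =
    trans (cong (lookup R (s e) ∨_) (anyFin-intro m _ e found)) (∨-zeroʳ _)
    where
    found : enters F R (s e) e ≡ true
    found rewrite e∈F | t∈R | ==-refl (s e) = ∨-zeroʳ _

  enters⇒endpoint∈ : ∀ F R w e → enters F R w e ≡ true →
    ∃ λ x → lookup R x ≡ true × incident ends e x ≡ true × incident ends e w ≡ true
  enters⇒endpoint∈ F R w e entering with ∨≡true _ _ (∧-conicalʳ (lookup F e) _ entering)
  ... | inj₁ via-src = s e , ∧-conicalˡ _ _ via-src , incident-src e refl , incident-tgt e (==⇒≡ (∧-conicalʳ _ _ via-src))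
  ... | inj₂ via-tgt = t e , ∧-conicalˡ _ _ via-tgt , incident-tgt e refl , incident-src e (==⇒≡ (∧-conicalʳ _ _ via-tgt))

  step-fresh : ∀ F R w → lookup (step ends F R) w ≡ true → lookup R w ≡ false →
    ∃ λ e → lookup F e ≡ true × incident ends e w ≡ true × lookup R (other e w) ≡ true
  step-fresh F R w w∈step w∉R
    with e , entering ← anyFin-elim m (enters F R w)
                          (subst (λ b → (b ∨ anyFin m (enters F R w)) ≡ true) w∉R (trans (sym (step-lookup F R w)) w∈step))
    with x , x∈R , e∋x , e∋w ← enters⇒endpoint∈ F R w e entering =
    e , ∧-conicalˡ (lookup F e) _ entering , e∋w , subst (λ y → lookup R y ≡ true) (sym (other-endpoint e e∋w e∋x x≢w)) x∈R
    where
    x≢w : x ≢ w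
    x≢w x≡w = case trans (sym w∉R) (subst (λ y → lookup R y ≡ true) x≡w x∈R) of λ ()

  iter-⊇ : ∀ k F R w → lookup R w ≡ true → lookup (iter ends k F R) w ≡ true
  iter-⊇ zero F R w w∈R = w∈R
  iter-⊇ (suc k) F R w w∈R = step-⊇ F (iter ends k F R) w (iter-⊇ k F R w w∈R)

  Closed : Subset m → Subset n → Set
  Closed F C = ∀ w → lookup (step ends F C) w ≡ true → lookup C w ≡ true

  closed-or-grows : ∀ F C → Closed F C ⊎ ∃ λ w → lookup (step ends F C) w ≡ true × lookup C w ≡ false
  closed-or-grows F C with anyFin n (λ w → lookup (step ends F C) w ∧ not (lookup C w)) in new
  ... | true with w , w-new ← anyFin-elim n _ new = inj₂ (w , ∧-conicalˡ _ _ w-new , not-injective (∧-conicalʳ _ _ w-new))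
  ... | false = inj₁ closed
    where
    closed : Closed F C
    closed w w∈step with lookup C w in w∈C
    ... | true = refl
    ... | false with () ← trans (sym new) (anyFin-intro n _ w (cong₂ (λ a b → a ∧ not b) w∈step w∈C))

  grows⇒∣∣< : ∀ F C w → lookup (step ends F C) w ≡ true → lookup C w ≡ false → ∣ C ∣ < ∣ step ends F C ∣
  grows⇒∣∣< F C w w∈step w∉C =
    p⊂q⇒∣p∣<∣q∣ {p = C} {q = step ends F C} ((λ x∈C → lookup⇒∈ (step-⊇ F C _ (∈⇒lookup x∈C))) , w , lookup⇒∈ w∈step , false⇒∉ w∉C)

  closed⇒step≡ : ∀ F C → Closed F C → step ends F C ≡ C
  closed⇒step≡ F C closed = lookup-ext (λ w → ≡-from-true⇔ (closed w) (step-⊇ F C w))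

  step-closed-or-larger : ∀ F C k → Closed F C ⊎ k ≤ ∣ C ∣ → Closed F (step ends F C) ⊎ suc k ≤ ∣ step ends F C ∣
  step-closed-or-larger F C k closed-or-large with closed-or-large | closed-or-grows F C
  ... | _ | inj₁ closed = inj₁ (subst (Closed F) (sym (closed⇒step≡ F C closed)) closed)
  ... | inj₁ closed | inj₂ (w , w∈step , w∉C) with () ← trans (sym (closed w w∈step)) w∉C
  ... | inj₂ large  | inj₂ (w , w∈step , w∉C) = inj₂ (≤-<-trans large (grows⇒∣∣< F C w w∈step w∉C))

  iter-closed-or-large : ∀ F v k → Closed F (iter ends k F ⁅ v ⁆) ⊎ suc k ≤ ∣ iter ends k F ⁅ v ⁆ ∣
  iter-closed-or-large F v zero = inj₂ (subst (1 ≤_) (sym (∣⁅x⁆∣≡1 v)) ≤-refl)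
  iter-closed-or-large F v (suc k) = step-closed-or-larger F (iter ends k F ⁅ v ⁆) (suc k) (iter-closed-or-large F v k)

  -- Each strict step adds a vertex, so the iteration is stationary after n steps.
  reach-closed : ∀ F v → Closed F (reach ends F v)
  reach-closed F v with iter-closed-or-large F v n
  ... | inj₁ closed = closed
  ... | inj₂ large = ⊥-elim (<-irrefl refl (≤-trans large (∣p∣≤n (reach ends F v))))

  closed-edge : ∀ F C e {x y} → Closed F C → lookup F e ≡ true →
    incident ends e x ≡ true → incident ends e y ≡ true → lookup C x ≡ true → lookup C y ≡ true
  closed-edge F C e {x} {y} closed e∈F e∋x e∋y x∈C with incident-elim e x e∋x | incident-elim e y e∋y
  ... | inj₁ refl | inj₁ refl = x∈C
  ... | inj₂ refl | inj₂ refl = x∈C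
  ... | inj₁ refl | inj₂ refl = closed (t e) (step-src→tgt F C e e∈F x∈C)
  ... | inj₂ refl | inj₁ refl = closed (s e) (step-tgt→src F C e e∈F x∈C)

  Choice : Set
  Choice = Fin n → Maybe (Fin m)

  follow : Choice → Fin n → Fin n
  follow f x = maybe′ (λ e → other e x) x (f x)

  follow-just : ∀ f {x e} → f x ≡ just e → follow f x ≡ other e x
  follow-just f fx rewrite fx = refl

  follow-nothing : ∀ f {x} → f x ≡ nothing → follow f x ≡ x
  follow-nothing f fx rewrite fx = refl

  selects : Maybe (Fin m) → Fin m → Bool
  selects nothing  e = false
  selects (just e′) e = e′ == e

  selects⇒≡ : ∀ o e → selects o e ≡ true → o ≡ just e
  selects⇒≡ (just e′) e e′=e = cong just (==⇒≡ e′=e)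

  chosenEdges : Subset n → Choice → Subset m
  chosenEdges S f = tabulate (λ e → anyFin n (λ v → lookup S v ∧ selects (f v) e))

  chosenEdges-elim : ∀ S f e → lookup (chosenEdges S f) e ≡ true → ∃ λ v → lookup S v ≡ true × f v ≡ just e
  chosenEdges-elim S f e e∈
    with v , chosen ← anyFin-elim n _ (trans (sym (lookup∘tabulate _ e)) e∈)
    = v , ∧-conicalˡ _ _ chosen , selects⇒≡ (f v) e (∧-conicalʳ _ _ chosen)

  chosenEdges-intro : ∀ S f {e} v → lookup S v ≡ true → f v ≡ just e → lookup (chosenEdges S f) e ≡ true
  chosenEdges-intro S f {e} v v∈S fv =
    trans (lookup∘tabulate _ e) (anyFin-intro n _ v (cong₂ _∧_ v∈S (trans (cong (λ o → selects o e) fv) (==-refl e))))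

  -- Arborescences rooted at u

  module _ (loopless : Loopless ends) (u : Fin n) where

    other-≢ : ∀ e v → incident ends e v ≡ true → other e v ≢ v
    other-≢ e v e∋v o≡v with incident-other e v e∋v
    ... | inj₁ (s≡v , t≡o) = loopless e (trans s≡v (sym (trans t≡o o≡v)))
    ... | inj₂ (t≡v , s≡o) = loopless e (trans (trans s≡o o≡v) (sym t≡v))

    other-other : ∀ e v → incident ends e v ≡ true → other e (other e v) ≡ v
    other-other e v e∋v with incident-endpoints e (other e v) v (other-incident e v e∋v) e∋v
    ... | inj₁ v≡o = ⊥-elim (other-≢ e v e∋v (sym v≡o))
    ... | inj₂ v≡oo = sym v≡oo

    record IsArborescence (S : Subset n) (f : Choice) : Set where
      field
        root∈ : lookup S u ≡ true
        root-unassigned : f u ≡ nothing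
        parent : ∀ v → lookup S v ≡ true → v ≢ u →
          ∃ λ e → f v ≡ just e × incident ends e v ≡ true × lookup S (other e v) ≡ true
        reaches-root : ∀ v → lookup S v ≡ true → applyN (follow f) n v ≡ u

    module IsArborescenceProperties {S : Subset n} {f : Choice} (A : IsArborescence S f) where
      open IsArborescence A

      follow-root : follow f u ≡ u
      follow-root = follow-nothing f root-unassigned

      assigned⇒≢root : ∀ {v e} → f v ≡ just e → v ≢ u
      assigned⇒≢root fv refl with () ← trans (sym root-unassigned) fv

      parent-edge : ∀ {v e} → lookup S v ≡ true → f v ≡ just e →
        incident ends e v ≡ true × lookup S (other e v) ≡ true
      parent-edge {v} v∈S fv with parent v v∈S (assigned⇒≢root fv)
      ... | e , fv′ , e∋v , o∈S with refl ← just-injective (trans (sym fv′) fv) = e∋v , o∈S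

      follow-∈ : ∀ x → lookup S x ≡ true → lookup S (follow f x) ≡ true
      follow-∈ x x∈S with x ≟ u
      ... | yes refl = subst (λ y → lookup S y ≡ true) (sym follow-root) x∈S
      ... | no x≢u with e , fx , _ , o∈S ← parent x x∈S x≢u =
        subst (λ y → lookup S y ≡ true) (sym (follow-just f fx)) o∈S

      -- Two vertices choosing the same edge would follow each other forever and never reach u.
      assigned-injective : ∀ {v w e} → lookup S v ≡ true → lookup S w ≡ true → f v ≡ just e → f w ≡ just e → v ≡ w
      assigned-injective {v} {w} {e} v∈S w∈S fv fw
        with incident-endpoints e v w (proj₁ (parent-edge v∈S fv)) (proj₁ (parent-edge w∈S fw))
      ... | inj₁ w≡v = sym w≡v
      ... | inj₂ w≡o with applyN-2-cycle (follow f) v→w w→v n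
        where
        v→w : follow f v ≡ w
        v→w = trans (follow-just f fv) (sym w≡o)
        w→v : follow f w ≡ v
        w→v = trans (follow-just f fw) (trans (cong (other e) w≡o) (other-other e v (proj₁ (parent-edge v∈S fv))))
      ...   | inj₁ →v = ⊥-elim (assigned⇒≢root fv (trans (sym →v) (reaches-root v v∈S)))
      ...   | inj₂ →w = ⊥-elim (assigned⇒≢root fw (trans (sym →w) (reaches-root v v∈S)))

      assigned-count : ∀ v → sumFin m (λ e → ⟦ lookup S v ∧ selects (f v) e ⟧) ≡ ⟦ lookup S v ∧ not (v == u) ⟧
      assigned-count v with lookup S v in v∈S
      ... | false = sumOver-zero (allFin m) (λ _ → refl)
      ... | true with v ≟ u
      ...   | yes refl rewrite root-unassigned = sumOver-zero (allFin m) (λ _ → refl)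
      ...   | no v≢u with e , fv , _ ← parent v v∈S v≢u rewrite fv = sumFin-δ′ m e

      ⟦∈⟧-split : ∀ v → ⟦ lookup S v ⟧ ≡ ⟦ lookup S v ∧ not (v == u) ⟧ + ⟦ v == u ⟧
      ⟦∈⟧-split v with v ≟ u
      ... | yes refl rewrite root∈ = refl
      ... | no v≢u rewrite ∧-identityʳ (lookup S v) = sym (+-identityʳ _)

      -- Double counting the pairs (v, f v) with v ∈ S ∖ {u}.
      ∣chosenEdges∣+1≡∣S∣ : ∣ chosenEdges S f ∣ + 1 ≡ ∣ S ∣
      ∣chosenEdges∣+1≡∣S∣ = begin
        ∣ chosenEdges S f ∣ + 1
          ≡⟨ cong (_+ 1) (∣p∣≡sumFin (chosenEdges S f)) ⟩
        sumFin m (λ e → ⟦ lookup (chosenEdges S f) e ⟧) + 1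
          ≡⟨ cong (_+ 1) (sumOver-cong (allFin m) (λ e → cong ⟦_⟧ (lookup∘tabulate _ e))) ⟩
        sumFin m (λ e → ⟦ anyFin n (λ v → chose v e) ⟧) + 1
          ≡⟨ cong (_+ 1) (sumOver-cong (allFin m) (λ e → sym (sumFin-⟦⟧-unique n (λ v → chose v e) (unique e)))) ⟩
        sumFin m (λ e → sumFin n (λ v → ⟦ chose v e ⟧)) + 1
          ≡⟨ cong (_+ 1) (sumOver-comm (allFin m) (allFin n) (λ e v → ⟦ chose v e ⟧)) ⟩
        sumFin n (λ v → sumFin m (λ e → ⟦ chose v e ⟧)) + 1
          ≡⟨ cong₂ _+_ (sumOver-cong (allFin n) assigned-count) (sym (sumFin-δ n u)) ⟩
        sumFin n (λ v → ⟦ lookup S v ∧ not (v == u) ⟧) + sumFin n (λ v → ⟦ v == u ⟧)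
          ≡⟨ sym (sumOver-+ (allFin n) _ _) ⟩
        sumFin n (λ v → ⟦ lookup S v ∧ not (v == u) ⟧ + ⟦ v == u ⟧)
          ≡⟨ sumOver-cong (allFin n) (λ v → sym (⟦∈⟧-split v)) ⟩
        sumFin n (λ v → ⟦ lookup S v ⟧)
          ≡⟨ sym (∣p∣≡sumFin S) ⟩
        ∣ S ∣ ∎
        where
        open ≡-Reasoning
        chose : Fin n → Fin m → Bool
        chose v e = lookup S v ∧ selects (f v) e
        unique : ∀ e v w → chose v e ≡ true → chose w e ≡ true → v ≡ w
        unique e v w v-chose w-chose =
          assigned-injective (∧-conicalˡ _ _ v-chose) (∧-conicalˡ _ _ w-chose)
            (selects⇒≡ (f v) e (∧-conicalʳ _ _ v-chose)) (selects⇒≡ (f w) e (∧-conicalʳ _ _ w-chose))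

      follow-closed : ∀ C → Closed (chosenEdges S f) C → ∀ x → lookup S x ≡ true → lookup C x ≡ lookup C (follow f x)
      follow-closed C closed x x∈S with x ≟ u
      ... | yes refl = cong (lookup C) (sym follow-root)
      ... | no x≢u with e , fx , e∋x , _ ← parent x x∈S x≢u =
        trans (≡-from-true⇔ (closed-edge (chosenEdges S f) C e closed e∈F e∋x e∋o) (closed-edge (chosenEdges S f) C e closed e∈F e∋o e∋x))
              (cong (lookup C) (sym (follow-just f fx)))
        where
        e∈F : lookup (chosenEdges S f) e ≡ true
        e∈F = chosenEdges-intro S f x x∈S fx
        e∋o : incident ends e (other e x) ≡ true
        e∋o = other-incident e x e∋x

      -- A closed set contains both ends of each chosen edge or neither, so membership is constant along routes to u.
      closed-constant : ∀ C → Closed (chosenEdges S f) C → ∀ x → lookup S x ≡ true → lookup C x ≡ lookup C u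
      closed-constant C closed x x∈S = trans (along n x x∈S) (cong (lookup C) (reaches-root x x∈S))
        where
        along : ∀ k x → lookup S x ≡ true → lookup C x ≡ lookup C (applyN (follow f) k x)
        along zero x _ = refl
        along (suc k) x x∈S = trans (follow-closed C closed x x∈S) (along k (follow f x) (follow-∈ x x∈S))

      chosenEdges-subgraph : isSubgraph ends S (chosenEdges S f) ≡ true
      chosenEdges-subgraph = allFin?-intro m _ inside-S
        where
        inside-S : ∀ e → (not (lookup (chosenEdges S f) e) ∨ inside ends S e) ≡ true
        inside-S e with lookup (chosenEdges S f) e in e∈
        ... | false = refl
        ... | true with v , v∈S , fv ← chosenEdges-elim S f e e∈ with e∋v , o∈S ← parent-edge v∈S fv =
          uncurry (cong₂ _∧_) (endpoints-in S e v e∋v v∈S o∈S)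

      chosenEdges-connected : connected ends S (chosenEdges S f) ≡ true
      chosenEdges-connected = allFin?-intro n _ (λ v → allFin?-intro n _ (joined v))
        where
        joined : ∀ v w → (not (lookup S v) ∨ not (lookup S w) ∨ lookup (reach ends (chosenEdges S f) v) w) ≡ true
        joined v w with lookup S v in v∈S | lookup S w in w∈S
        ... | false | _     = refl
        ... | true  | false = refl
        ... | true  | true  = begin
          lookup C w ≡⟨ closed-constant C C-closed w w∈S ⟩
          lookup C u ≡⟨ sym (closed-constant C C-closed v v∈S) ⟩
          lookup C v ≡⟨ iter-⊇ n (chosenEdges S f) ⁅ v ⁆ v (∈⇒lookup (x∈⁅x⁆ v)) ⟩
          true       ∎
          where
          open ≡-Reasoning
          C : Subset n
          C = reach ends (chosenEdges S f) v
          C-closed : Closed (chosenEdges S f) C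
          C-closed = reach-closed (chosenEdges S f) v

      arborescence⇒isTree : isTree ends S (chosenEdges S f) ≡ true
      arborescence⇒isTree =
        cong₂ _∧_ chosenEdges-subgraph (cong₂ _∧_ chosenEdges-connected (cong₂ _∧_ size nonempty))
        where
        F : Subset m
        F = chosenEdges S f
        size : ⌊ ∣ F ∣ ℕ.≟ ∣ S ∣ ∸ 1 ⌋ ≡ true
        size = witness⇒true (∣ F ∣ ℕ.≟ ∣ S ∣ ∸ 1) (sym (trans (cong (_∸ 1) (sym ∣chosenEdges∣+1≡∣S∣)) (m+n∸n≡m ∣ F ∣ 1)))
        nonempty : ⌊ 1 ℕ.≤? ∣ S ∣ ⌋ ≡ true
        nonempty = witness⇒true (1 ℕ.≤? ∣ S ∣) (subst (1 ≤_) ∣chosenEdges∣+1≡∣S∣ (m≤n+m 1 ∣ F ∣))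

    arborescence-unique : ∀ {S f g} → IsArborescence S f → IsArborescence S g → chosenEdges S f ≡ chosenEdges S g →
      ∀ v → lookup S v ≡ true → f v ≡ g v
    arborescence-unique {S} {f} {g} af ag same v v∈S = agree n v v∈S (reaches-root v v∈S)
      where
      open IsArborescence af
      open IsArborescenceProperties af using (assigned-injective)
      module G = IsArborescence ag
      open IsArborescenceProperties ag using () renaming (parent-edge to parent-edgeᵍ)
      agree : ∀ k v → lookup S v ≡ true → applyN (follow f) k v ≡ u → f v ≡ g v
      agree zero v v∈S refl = trans root-unassigned (sym G.root-unassigned)
      agree (suc k) v v∈S reached with v ≟ u
      ... | yes refl = trans root-unassigned (sym G.root-unassigned)
      ... | no v≢u
        with e , fv , e∋v , o∈S ← parent v v∈S v≢u
        with w , w∈S , gw ← chosenEdges-elim S g e (subst (λ F → lookup F e ≡ true) same (chosenEdges-intro S f v v∈S fv))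
        with incident-endpoints e v w e∋v (proj₁ (parent-edgeᵍ w∈S gw))
      ... | inj₁ refl = trans fv (sym gw)
      ... | inj₂ refl = ⊥-elim (other-≢ e v e∋v (assigned-injective o∈S v∈S (trans fo gw) fv))
        where
        fo : f (other e v) ≡ g (other e v)
        fo = agree k (other e v) o∈S (trans (cong (applyN (follow f) k) (sym (follow-just f fv))) reached)

    -- Orient every edge of the tree towards u: each vertex v ≠ u picks an incident tree edge leading
    -- to a vertex at smaller distance from u, where the distance is the first round in which the
    -- reachability iteration started at u meets v.
    module TreeOrientation (S : Subset n) (F : Subset m) (tree : isTree ends S F ≡ true) (u∈S : lookup S u ≡ true) where

      private
        size-ok nonempty : Bool
        size-ok = ⌊ ∣ F ∣ ℕ.≟ ∣ S ∣ ∸ 1 ⌋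
        nonempty = ⌊ 1 ℕ.≤? ∣ S ∣ ⌋

        subgraph : isSubgraph ends S F ≡ true
        subgraph = ∧-conicalˡ (isSubgraph ends S F) (connected ends S F ∧ size-ok ∧ nonempty) tree

        spanning : connected ends S F ∧ size-ok ∧ nonempty ≡ true
        spanning = ∧-conicalʳ (isSubgraph ends S F) (connected ends S F ∧ size-ok ∧ nonempty) tree

      other∈S : ∀ e v → lookup F e ≡ true → incident ends e v ≡ true → lookup S (other e v) ≡ true
      other∈S e v e∈F e∋v
        with ends-in ← ∧≡true (lookup S (src ends e)) (lookup S (tgt ends e))
               (subst (λ b → (not b ∨ inside ends S e) ≡ true) e∈F (allFin?-elim m _ subgraph e))
        with incident-other e v e∋v
      ... | inj₁ (_ , t≡o) = subst (λ x → lookup S x ≡ true) t≡o (proj₂ ends-in)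
      ... | inj₂ (_ , s≡o) = subst (λ x → lookup S x ≡ true) s≡o (proj₁ ends-in)

      reached : ∀ v → lookup S v ≡ true → lookup (reach ends F u) v ≡ true
      reached v v∈S = subst₂ (λ a b → (not a ∨ not b ∨ lookup (reach ends F u) v) ≡ true) u∈S v∈S
        (allFin?-elim n _ (allFin?-elim n _ (∧-conicalˡ (connected ends S F) (size-ok ∧ nonempty) spanning) u) v)

      ∣F∣≡∣S∣∸1 : ∣ F ∣ ≡ ∣ S ∣ ∸ 1
      ∣F∣≡∣S∣∸1 = true⇒witness (∣ F ∣ ℕ.≟ ∣ S ∣ ∸ 1)
        (∧-conicalˡ size-ok nonempty (∧-conicalʳ (connected ends S F) (size-ok ∧ nonempty) spanning))

      level : Fin n → ℕ
      level x = least (λ k → lookup (iter ends k F ⁅ u ⁆) x) (suc n)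

      level≤ : ∀ x j → lookup (iter ends j F ⁅ u ⁆) x ≡ true → level x ≤ j
      level≤ x = least≤ (λ k → lookup (iter ends k F ⁅ u ⁆) x) (suc n)

      at-level : ∀ x → lookup S x ≡ true → lookup (iter ends (level x) F ⁅ u ⁆) x ≡ true
      at-level x x∈S = least-sound (λ k → lookup (iter ends k F ⁅ u ⁆) x) (suc n) n ≤-refl (reached x x∈S)

      descends : Fin n → Fin m → Bool
      descends v e = lookup F e ∧ incident ends e v ∧ ⌊ level (other e v) ℕ.<? level v ⌋

      descends-elim : ∀ {v e} → descends v e ≡ true →
        lookup F e ≡ true × incident ends e v ≡ true × level (other e v) < level v
      descends-elim {v} {e} d with ∧≡true _ _ d
      ... | e∈F , rest with ∧≡true _ _ rest
      ...   | e∋v , lower = e∈F , e∋v , true⇒witness (level (other e v) ℕ.<? level v) lower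

      descending-edge : ∀ v → lookup S v ≡ true → v ≢ u → ∃ λ e → descends v e ≡ true
      descending-edge v v∈S v≢u with level v in lv | at-level v v∈S
      ... | zero  | v∈⁅u⁆ = ⊥-elim (v≢u (x∈⁅y⁆⇒x≡y u (lookup⇒∈ v∈⁅u⁆)))
      ... | suc k | v∈step with lookup (iter ends k F ⁅ u ⁆) v in v∈iter
      ...   | true  = ⊥-elim (<-irrefl refl (subst (_≤ k) lv (level≤ v k v∈iter)))
      ...   | false with e , e∈F , e∋v , o∈iter ← step-fresh F (iter ends k F ⁅ u ⁆) v v∈step v∈iter =
        e , cong₂ _∧_ e∈F (cong₂ _∧_ e∋v (witness⇒true (level (other e v) ℕ.<? suc k) (s≤s (level≤ (other e v) k o∈iter))))

      orientation : Choice
      orientation v = if lookup S v ∧ not (v == u) then find m (descends v) else nothing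

      orientation-root : orientation u ≡ nothing
      orientation-root rewrite ==-refl u | ∧-zeroʳ (lookup S u) = refl

      orientation-descends : ∀ v → lookup S v ≡ true → v ≢ u → ∃ λ e → orientation v ≡ just e × descends v e ≡ true
      orientation-descends v v∈S v≢u
        with e₀ , d₀ ← descending-edge v v∈S v≢u
        with e , found ← find-complete m (descends v) e₀ d₀ =
        e , trans (cong (λ b → if b then find m (descends v) else nothing) (cong₂ _∧_ v∈S (cong not (≢⇒== v≢u)))) found
          , find-sound m (descends v) found

      orientation-arborescence : IsArborescence S orientation
      orientation-arborescence = record
        { root∈ = u∈S
        ; root-unassigned = orientation-root
        ; parent = parent
        ; reaches-root = λ v v∈S → descend n v v∈S (level≤ v n (reached v v∈S))
        }
        where
        parent : ∀ v → lookup S v ≡ true → v ≢ u →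
          ∃ λ e → orientation v ≡ just e × incident ends e v ≡ true × lookup S (other e v) ≡ true
        parent v v∈S v≢u with e , ov , d ← orientation-descends v v∈S v≢u with e∈F , e∋v , _ ← descends-elim d =
          e , ov , e∋v , other∈S e v e∈F e∋v
        descend : ∀ k x → lookup S x ≡ true → level x ≤ k → applyN (follow orientation) k x ≡ u
        descend zero x x∈S lx≤0 =
          x∈⁅y⁆⇒x≡y u (lookup⇒∈ (subst (λ j → lookup (iter ends j F ⁅ u ⁆) x ≡ true) (n≤0⇒n≡0 lx≤0) (at-level x x∈S)))
        descend (suc k) x x∈S lx≤ = descend-from (x ≟ u)
          where
          descend-from : Dec (x ≡ u) → applyN (follow orientation) (suc k) x ≡ u
          descend-from (yes refl) = applyN-fixed (follow orientation) (suc k) (follow-nothing orientation orientation-root)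
          descend-from (no x≢u) with e , ox , d ← orientation-descends x x∈S x≢u with e∈F , e∋x , lower ← descends-elim d =
            trans (cong (applyN (follow orientation) k) (follow-just orientation ox))
                  (descend k (other e x) (other∈S e x e∈F e∋x) (≤-pred (≤-trans lower lx≤)))

      chosenEdges-orientation : chosenEdges S orientation ≡ F
      chosenEdges-orientation = ⊆∧∣∣≡⇒≡ chosen⊆F (begin
        ∣ chosenEdges S orientation ∣           ≡⟨ sym (m+n∸n≡m _ 1) ⟩
        ∣ chosenEdges S orientation ∣ + 1 ∸ 1   ≡⟨ cong (_∸ 1) (∣chosenEdges∣+1≡∣S∣ orientation-arborescence) ⟩
        ∣ S ∣ ∸ 1                               ≡⟨ sym ∣F∣≡∣S∣∸1 ⟩
        ∣ F ∣                                   ∎)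
        where
        open ≡-Reasoning
        open IsArborescenceProperties using (∣chosenEdges∣+1≡∣S∣; assigned⇒≢root)
        chosen⊆F : chosenEdges S orientation ⊆ F
        chosen⊆F {e} e∈
          with v , v∈S , ov ← chosenEdges-elim S orientation e (∈⇒lookup e∈)
          with e′ , ov′ , d ← orientation-descends v v∈S (assigned⇒≢root orientation-arborescence ov)
          with refl ← just-injective (trans (sym ov′) ov) = lookup⇒∈ (proj₁ (descends-elim d))

    tree⇒arborescence : ∀ S F → isTree ends S F ≡ true → lookup S u ≡ true →
      ∃ λ a → IsArborescence S a × chosenEdges S a ≡ F
    tree⇒arborescence S F tree u∈S = orientation , orientation-arborescence , chosenEdges-orientation
      where open TreeOrientation S F tree u∈S

    -- Choice functions

    admissible : Fin n → Maybe (Fin m) → Bool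
    admissible v nothing  = v == u
    admissible v (just e) = not (v == u) ∧ incident ends e v

    isChoice : Choice → Bool
    isChoice f = allFin? n (λ v → admissible v (f v))

    basin : Choice → Subset n
    basin f = tabulate (λ v → applyN (follow f) n v == u)

    basin-lookup : ∀ f v → lookup (basin f) v ≡ (applyN (follow f) n v == u)
    basin-lookup f v = lookup∘tabulate _ v

    edgeOutside : Subset n → Fin n → Maybe (Fin m) → Bool
    edgeOutside S v nothing  = false
    edgeOutside S v (just e) = incident ends e v ∧ not (lookup S (src ends e)) ∧ not (lookup S (tgt ends e))

    module ChoiceProperties {f : Choice} (f-choice : isChoice f ≡ true) where

      admissible-at : ∀ v → admissible v (f v) ≡ true
      admissible-at = allFin?-elim n _ f-choice

      choice-root : f u ≡ nothing
      choice-root with f u | admissible-at u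
      ... | nothing | _ = refl
      ... | just e  | ok with () ← trans (cong (λ b → not b ∧ incident ends e u) (sym (==-refl u))) ok

      choice-assigned : ∀ v → v ≢ u → ∃ λ e → f v ≡ just e × incident ends e v ≡ true
      choice-assigned v v≢u with f v in fv | admissible-at v
      ... | nothing | v=u = ⊥-elim (v≢u (==⇒≡ v=u))
      ... | just e  | ok  = e , refl , ∧-conicalʳ _ _ ok

      follow-root : follow f u ≡ u
      follow-root = follow-nothing f choice-root

      reaches⇒∈basin : ∀ k v → applyN (follow f) k v ≡ u → lookup (basin f) v ≡ true
      reaches⇒∈basin k v reaches = trans (basin-lookup f v) (≡⇒== (applyN-within (follow f) follow-root k v reaches))

      ∈basin⇒reaches : ∀ {v} → lookup (basin f) v ≡ true → applyN (follow f) n v ≡ u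
      ∈basin⇒reaches {v} v∈ = ==⇒≡ (trans (sym (basin-lookup f v)) v∈)

      root∈basin : lookup (basin f) u ≡ true
      root∈basin = reaches⇒∈basin 0 u refl

      basin-arborescence : IsArborescence (basin f) f
      basin-arborescence = record
        { root∈ = root∈basin
        ; root-unassigned = choice-root
        ; parent = parent
        ; reaches-root = λ v → ∈basin⇒reaches
        }
        where
        parent : ∀ v → lookup (basin f) v ≡ true → v ≢ u →
          ∃ λ e → f v ≡ just e × incident ends e v ≡ true × lookup (basin f) (other e v) ≡ true
        parent v v∈ v≢u with e , fv , e∋v ← choice-assigned v v≢u = e , fv , e∋v , reaches⇒∈basin n (other e v) (begin
          applyN (follow f) n (other e v)   ≡⟨ cong (applyN (follow f) n) (sym (follow-just f fv)) ⟩
          applyN (follow f) (suc n) v       ≡⟨ applyN-suc (follow f) n v ⟩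
          follow f (applyN (follow f) n v)  ≡⟨ cong (follow f) (∈basin⇒reaches v∈) ⟩
          follow f u                        ≡⟨ follow-root ⟩
          u                                 ∎)
          where open ≡-Reasoning

      outside-basin : ∀ v → lookup (basin f) v ≡ false → edgeOutside (basin f) v (f v) ≡ true
      outside-basin v v∉ with v ≟ u
      ... | yes refl with () ← trans (sym root∈basin) v∉
      ... | no v≢u with e , fv , e∋v ← choice-assigned v v≢u rewrite fv =
        cong₂ _∧_ e∋v (cong₂ _∧_ (cong not (endpoint∉ (incident-src e refl))) (cong not (endpoint∉ (incident-tgt e refl))))
        where
        endpoint∉ : ∀ {x} → incident ends e x ≡ true → lookup (basin f) x ≡ false
        endpoint∉ e∋x with incident-endpoints e v _ e∋v e∋x
        ... | inj₁ refl = v∉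
        ... | inj₂ refl = ≢true⇒≡false λ o∈ →
          case trans (sym v∉) (reaches⇒∈basin (suc n) v (trans (cong (applyN (follow f) n) (follow-just f fv)) (∈basin⇒reaches o∈))) of λ ()

    _≟ᵐ_ : (o o′ : Maybe (Fin m)) → Dec (o ≡ o′)
    _≟ᵐ_ = MaybeP.≡-dec _≟_

    extends : Subset n → Choice → Fin n → Maybe (Fin m) → Bool
    extends S a v o = if lookup S v then does (o ≟ᵐ a v) else edgeOutside S v o

    module Extension {S : Subset n} {a : Choice} (A : IsArborescence S a)
                     {f : Choice} (f-extends : ∀ v → extends S a v (f v) ≡ true) where
      open IsArborescence A

      agrees : ∀ {v} → lookup S v ≡ true → f v ≡ a v
      agrees {v} v∈S = does⇒witness (f v ≟ᵐ a v) (trans (sym (cong (λ b → if b then does (f v ≟ᵐ a v) else edgeOutside S v (f v)) v∈S)) (f-extends v))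

      outside : ∀ {v} → lookup S v ≡ false →
        ∃ λ e → f v ≡ just e × incident ends e v ≡ true × lookup S (src ends e) ≡ false × lookup S (tgt ends e) ≡ false
      outside {v} v∉S with f v in fv | trans (sym (cong (λ b → if b then does (f v ≟ᵐ a v) else edgeOutside S v (f v)) v∉S)) (f-extends v)
      ... | just e | ok with e∋v , rest ← ∧≡true _ _ ok with s∉ , t∉ ← ∧≡true _ _ rest =
        e , refl , e∋v , not-injective s∉ , not-injective t∉

      admissible-everywhere : isChoice f ≡ true
      admissible-everywhere = allFin?-intro n _ admissible-f
        where
        admissible-f : ∀ v → admissible v (f v) ≡ true
        admissible-f v with v ≟ u
        ... | yes refl = subst (λ o → admissible u o ≡ true) (sym (trans (agrees root∈) root-unassigned)) (==-refl u)
        ... | no v≢u with lookup S v in v∈S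
        ...   | true with e , av , e∋v , _ ← parent v v∈S v≢u =
          subst (λ o → admissible v o ≡ true) (sym (trans (agrees v∈S) av)) (cong₂ _∧_ (cong not (≢⇒== v≢u)) e∋v)
        ...   | false with e , fv , e∋v , _ ← outside v∈S =
          subst (λ o → admissible v o ≡ true) (sym fv) (cong₂ _∧_ (cong not (≢⇒== v≢u)) e∋v)

      stays-outside : ∀ k x → lookup S x ≡ false → lookup S (applyN (follow f) k x) ≡ false
      stays-outside zero x x∉S = x∉S
      stays-outside (suc k) x x∉S with e , fx , e∋x , s∉S , t∉S ← outside x∉S =
        stays-outside k (follow f x) (subst (λ y → lookup S y ≡ false) (sym (follow-just f fx)) o∉S)
        where
        o∉S : lookup S (other e x) ≡ false
        o∉S with incident-other e x e∋x
        ... | inj₁ (_ , t≡o) = subst (λ y → lookup S y ≡ false) t≡o t∉S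
        ... | inj₂ (_ , s≡o) = subst (λ y → lookup S y ≡ false) s≡o s∉S

      same-route : ∀ k x → lookup S x ≡ true → applyN (follow f) k x ≡ applyN (follow a) k x
      same-route zero x _ = refl
      same-route (suc k) x x∈S =
        trans (cong (λ o → applyN (follow f) k (maybe′ (λ e → other e x) x o)) (agrees x∈S))
              (same-route k (follow a x) (IsArborescenceProperties.follow-∈ A x x∈S))

      extension-basin : basin f ≡ S
      extension-basin = lookup-ext (λ v → trans (basin-lookup f v) (≡-from-true⇔ (into v) (from v)))
        where
        into : ∀ v → (applyN (follow f) n v == u) ≡ true → lookup S v ≡ true
        into v reaches with lookup S v in v∈S
        ... | true = refl
        ... | false with () ← trans (sym (stays-outside n v v∈S)) (trans (cong (lookup S) (==⇒≡ reaches)) root∈)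
        from : ∀ v → lookup S v ≡ true → (applyN (follow f) n v == u) ≡ true
        from v v∈S = ≡⇒== (trans (same-route n v v∈S) (reaches-root v v∈S))

      extension-chosenEdges : chosenEdges S f ≡ chosenEdges S a
      extension-chosenEdges = lookup-ext (λ e →
        trans (lookup∘tabulate _ e) (trans (anyFin-cong n (same-choice e)) (sym (lookup∘tabulate _ e))))
        where
        same-choice : ∀ e v → (lookup S v ∧ selects (f v) e) ≡ (lookup S v ∧ selects (a v) e)
        same-choice e v with lookup S v in v∈S
        ... | true = cong (λ o → selects o e) (agrees v∈S)
        ... | false = refl

    options : List (Maybe (Fin m))
    options = nothing ∷ map just (allFin m)

    sumOver-options : ∀ (g : Maybe (Fin m) → ℕ) → sumOver options g ≡ g nothing + sumFin m (g ∘ just)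
    sumOver-options g = cong (g nothing +_) (sumOver-map (allFin m) just g)

    choices : List (Vec (Maybe (Fin m)) n)
    choices = allVecs options n

    admissible-count : ∀ v → sumOver options (λ o → ⟦ admissible v o ⟧) ≡ (if v == u then 1 else deg ends v)
    admissible-count v rewrite sumOver-options (λ o → ⟦ admissible v o ⟧) with v == u
    ... | true = cong suc (sumOver-zero (allFin m) (λ _ → refl))
    ... | false = sumOver-cong (allFin m) (λ e → cong ⟦_⟧ (trans (sym (∧-identityʳ _)) (cong (incident ends e v ∧_) (sym (no-deletion e)))))
      where
      no-deletion : ∀ e → (not (lookup ⊥ (src ends e)) ∧ not (lookup ⊥ (tgt ends e))) ≡ true
      no-deletion e rewrite lookup-replicate (src ends e) false | lookup-replicate (tgt ends e) false = refl

    prodDegExcept-choices : prodDegExcept ends u ≡ sumOver choices (λ fv → ⟦ isChoice (lookup fv) ⟧)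
    prodDegExcept-choices = begin
      prodDegExcept ends u
        ≡⟨ prodFin-cong n (λ v → sym (admissible-count v)) ⟩
      prodFin n (λ v → sumOver options (λ o → ⟦ admissible v o ⟧))
        ≡⟨ prodFin-sumOver options n (λ v o → ⟦ admissible v o ⟧) ⟩
      sumOver choices (λ fv → prodFin n (λ v → ⟦ admissible v (lookup fv v) ⟧))
        ≡⟨ sumOver-cong choices (λ fv → prodFin-⟦⟧ n (λ v → admissible v (lookup fv v))) ⟩
      sumOver choices (λ fv → ⟦ isChoice (lookup fv) ⟧) ∎
      where open ≡-Reasoning

    decomposes : Subset n → Subset m → Choice → Bool
    decomposes S F f = does (S ≟ˢ basin f) ∧ does (F ≟ˢ chosenEdges (basin f) f) ∧ isChoice f

    isChoice-decomposes : ∀ f →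
      ⟦ isChoice f ⟧ ≡ sumOver (allSubsets n) (λ S → sumOver (allSubsets m) (λ F → ⟦ decomposes S F f ⟧))
    isChoice-decomposes f = sym (begin
      sumOver (allSubsets n) (λ S → sumOver (allSubsets m) (λ F → ⟦ decomposes S F f ⟧))
        ≡⟨ sumOver-cong (allSubsets n) (λ S → sumOver-cong (allSubsets m) (λ F → sym (factor S F))) ⟩
      sumOver (allSubsets n) (λ S → sumOver (allSubsets m) (λ F → ⟦ does (S ≟ˢ B) ⟧ * (⟦ does (F ≟ˢ C) ⟧ * ⟦ isChoice f ⟧)))
        ≡⟨ sumOver-cong (allSubsets n) (λ S → sym (*-distribˡ-sumOver ⟦ does (S ≟ˢ B) ⟧ (allSubsets m) _)) ⟩
      sumOver (allSubsets n) (λ S → ⟦ does (S ≟ˢ B) ⟧ * sumOver (allSubsets m) (λ F → ⟦ does (F ≟ˢ C) ⟧ * ⟦ isChoice f ⟧))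
        ≡⟨ sumOver-allSubsets-δ n B _ ⟩
      sumOver (allSubsets m) (λ F → ⟦ does (F ≟ˢ C) ⟧ * ⟦ isChoice f ⟧)
        ≡⟨ sumOver-allSubsets-δ m C _ ⟩
      ⟦ isChoice f ⟧ ∎)
      where
      open ≡-Reasoning
      B : Subset n
      B = basin f
      C : Subset m
      C = chosenEdges B f
      factor : ∀ S F → ⟦ does (S ≟ˢ B) ⟧ * (⟦ does (F ≟ˢ C) ⟧ * ⟦ isChoice f ⟧) ≡ ⟦ decomposes S F f ⟧
      factor S F = trans (cong (⟦ does (S ≟ˢ B) ⟧ *_) (⟦∧⟧ (does (F ≟ˢ C)) (isChoice f))) (⟦∧⟧ (does (S ≟ˢ B)) (does (F ≟ˢ C) ∧ isChoice f))

    decomposes⇒rooted-tree : ∀ S F f → decomposes S F f ≡ true → (isTree ends S F ∧ lookup S u) ≡ true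
    decomposes⇒rooted-tree S F f d
      with S≡B , rest ← ∧≡true (does (S ≟ˢ basin f)) (does (F ≟ˢ chosenEdges (basin f) f) ∧ isChoice f) d
      with F≡C , f-choice ← ∧≡true (does (F ≟ˢ chosenEdges (basin f) f)) (isChoice f) rest
      with refl ← does⇒witness (S ≟ˢ basin f) S≡B
      with refl ← does⇒witness (F ≟ˢ chosenEdges (basin f) f) F≡C =
      cong₂ _∧_ arborescence⇒isTree root∈basin
      where
      open ChoiceProperties {f} f-choice
      open IsArborescenceProperties basin-arborescence

    module _ {S : Subset n} {F : Subset m} {a : Choice} (A : IsArborescence S a) (a-spans : chosenEdges S a ≡ F) where

      decomposes⇔extends : ∀ f → decomposes S F f ≡ allFin? n (λ v → extends S a v (f v))
      decomposes⇔extends f = ≡-from-true⇔ to from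
        where
        to : decomposes S F f ≡ true → allFin? n (λ v → extends S a v (f v)) ≡ true
        to d
          with S≡B , rest ← ∧≡true (does (S ≟ˢ basin f)) (does (F ≟ˢ chosenEdges (basin f) f) ∧ isChoice f) d
          with F≡C , f-choice ← ∧≡true (does (F ≟ˢ chosenEdges (basin f) f)) (isChoice f) rest
          with refl ← does⇒witness (S ≟ˢ basin f) S≡B
          with refl ← does⇒witness (F ≟ˢ chosenEdges (basin f) f) F≡C = allFin?-intro n _ extends-at
          where
          open ChoiceProperties {f} f-choice
          extends-at : ∀ v → extends (basin f) a v (f v) ≡ true
          extends-at v with lookup (basin f) v in v∈B
          ... | true  = dec-true (f v ≟ᵐ a v) (arborescence-unique basin-arborescence A (sym a-spans) v v∈B)
          ... | false = outside-basin v v∈B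
        from : allFin? n (λ v → extends S a v (f v)) ≡ true → decomposes S F f ≡ true
        from ext = cong₂ _∧_ (dec-true (S ≟ˢ basin f) (sym extension-basin))
                     (cong₂ _∧_ (dec-true (F ≟ˢ chosenEdges (basin f) f) F≡C) admissible-everywhere)
          where
          open Extension A {f} (allFin?-elim n _ ext)
          F≡C : F ≡ chosenEdges (basin f) f
          F≡C = trans (sym a-spans) (trans (sym extension-chosenEdges) (cong (λ B → chosenEdges B f) (sym extension-basin)))

      extends-count : ∀ v → sumOver options (λ o → ⟦ extends S a v o ⟧) ≡ (if lookup S v then 1 else degMinus ends S v)
      extends-count v rewrite sumOver-options (λ o → ⟦ extends S a v o ⟧) with lookup S v
      ... | false = refl
      ... | true with a v
      ...   | nothing = cong suc (sumOver-zero (allFin m) (λ _ → refl))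
      ...   | just e  = trans (sumOver-cong (allFin m) (λ i → cong ⟦_⟧ (sym (isYes≗does (i ≟ e))))) (sumFin-δ m e)

      count-extensions : sumOver choices (λ fv → ⟦ allFin? n (λ v → extends S a v (lookup fv v)) ⟧) ≡ prodDegOutside ends S
      count-extensions = begin
        sumOver choices (λ fv → ⟦ allFin? n (λ v → extends S a v (lookup fv v)) ⟧)
          ≡⟨ sumOver-cong choices (λ fv → sym (prodFin-⟦⟧ n (λ v → extends S a v (lookup fv v)))) ⟩
        sumOver choices (λ fv → prodFin n (λ v → ⟦ extends S a v (lookup fv v) ⟧))
          ≡⟨ sym (prodFin-sumOver options n (λ v o → ⟦ extends S a v o ⟧)) ⟩
        prodFin n (λ v → sumOver options (λ o → ⟦ extends S a v o ⟧))
          ≡⟨ prodFin-cong n extends-count ⟩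
        prodDegOutside ends S ∎
        where open ≡-Reasoning

    count-decompositions : ∀ S F →
      sumOver choices (λ fv → ⟦ decomposes S F (lookup fv) ⟧) ≡ (if isTree ends S F ∧ lookup S u then prodDegOutside ends S else 0)
    count-decompositions S F = by-cases (isTree ends S F ∧ lookup S u) refl
      where
      by-cases : ∀ b → (isTree ends S F ∧ lookup S u) ≡ b →
        sumOver choices (λ fv → ⟦ decomposes S F (lookup fv) ⟧) ≡ (if b then prodDegOutside ends S else 0)
      by-cases false not-rooted-tree = sumOver-zero choices (λ fv → cong ⟦_⟧ (≢true⇒≡false λ d →
        case trans (sym not-rooted-tree) (decomposes⇒rooted-tree S F (lookup fv) d) of λ ()))
      by-cases true rooted-tree = count-via (uncurry (tree⇒arborescence S F) (∧≡true (isTree ends S F) (lookup S u) rooted-tree))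
        where
        count-via : (∃ λ a → IsArborescence S a × chosenEdges S a ≡ F) →
          sumOver choices (λ fv → ⟦ decomposes S F (lookup fv) ⟧) ≡ prodDegOutside ends S
        count-via (a , A , a-spans) =
          trans (sumOver-cong choices (λ fv → cong ⟦_⟧ (decomposes⇔extends A a-spans (lookup fv)))) (count-extensions A a-spans)

    proper-⊤ : proper ends ⊤ ≡ false
    proper-⊤ = cong not (allFin?-intro n _ (λ v → lookup-replicate v true))

    prodDegOutside-⊤ : prodDegOutside ends ⊤ ≡ 1
    prodDegOutside-⊤ = begin
      prodDegOutside ends ⊤           ≡⟨ prodFin-cong n (λ v → cong (λ b → if b then 1 else degMinus ends ⊤ v) (lookup-replicate v true)) ⟩
      prodFin n (λ _ → ⟦ true ⟧)      ≡⟨ prodFin-⟦⟧ n (λ _ → true) ⟩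
      ⟦ allFin? n (λ _ → true) ⟧      ≡⟨ cong ⟦_⟧ (allFin?-intro n _ (λ _ → refl)) ⟩
      1                               ∎
      where open ≡-Reasoning

    ≢⊤⇒proper : ∀ {S} → S ≢ ⊤ → proper ends S ≡ true
    ≢⊤⇒proper {S} S≢⊤ = cong not (≢true⇒≡false λ all∈ →
      S≢⊤ (lookup-ext (λ v → trans (allFin?-elim n _ all∈ v) (sym (lookup-replicate v true)))))

    rooted-tree-split : ∀ S F →
      (if isTree ends S F ∧ lookup S u then prodDegOutside ends S else 0) ≡
      ⟦ does (S ≟ˢ ⊤) ⟧ * ⟦ isTree ends ⊤ F ⟧ +
      (if isTree ends S F ∧ lookup S u ∧ proper ends S then prodDegOutside ends S else 0)
    rooted-tree-split S F with S ≟ˢ ⊤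
    ... | yes refl rewrite lookup-replicate u true | proper-⊤ | prodDegOutside-⊤ | ∧-zeroʳ (isTree ends ⊤ F)
      with isTree ends ⊤ F
    ...   | true = refl
    ...   | false = refl
    rooted-tree-split S F | no S≢⊤ rewrite ≢⊤⇒proper S≢⊤ | ∧-identityʳ (lookup S u) = refl

    prodDegExcept≡τ+sumNST : prodDegExcept ends u ≡ τ ends + sumNST ends u
    prodDegExcept≡τ+sumNST = begin
      prodDegExcept ends u
        ≡⟨ prodDegExcept-choices ⟩
      sumOver choices (λ fv → ⟦ isChoice (lookup fv) ⟧)
        ≡⟨ sumOver-cong choices (isChoice-decomposes ∘ lookup) ⟩
      sumOver choices (λ fv → ΣS (λ S → ΣF (λ F → ⟦ decomposes S F (lookup fv) ⟧)))
        ≡⟨ sumOver-comm choices (allSubsets n) _ ⟩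
      ΣS (λ S → sumOver choices (λ fv → ΣF (λ F → ⟦ decomposes S F (lookup fv) ⟧)))
        ≡⟨ sumOver-cong (allSubsets n) (λ S → sumOver-comm choices (allSubsets m) _) ⟩
      ΣS (λ S → ΣF (λ F → sumOver choices (λ fv → ⟦ decomposes S F (lookup fv) ⟧)))
        ≡⟨ sumOver-cong (allSubsets n) (λ S → sumOver-cong (allSubsets m) (count-decompositions S)) ⟩
      ΣS (λ S → ΣF (λ F → if isTree ends S F ∧ lookup S u then prodDegOutside ends S else 0))
        ≡⟨ sumOver-cong (allSubsets n) (λ S → trans (sumOver-cong (allSubsets m) (rooted-tree-split S)) (sumOver-+ (allSubsets m) _ _)) ⟩
      ΣS (λ S → ΣF (λ F → ⟦ does (S ≟ˢ ⊤) ⟧ * ⟦ isTree ends ⊤ F ⟧) + ΣF (λ F → nonSpanning S F))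
        ≡⟨ sumOver-+ (allSubsets n) _ _ ⟩
      ΣS (λ S → ΣF (λ F → ⟦ does (S ≟ˢ ⊤) ⟧ * ⟦ isTree ends ⊤ F ⟧)) + sumNST ends u
        ≡⟨ cong (_+ sumNST ends u) (trans (sumOver-cong (allSubsets n) (λ S → sym (*-distribˡ-sumOver ⟦ does (S ≟ˢ ⊤) ⟧ (allSubsets m) (λ F → ⟦ isTree ends ⊤ F ⟧))))
                                          (sumOver-allSubsets-δ n ⊤ (λ _ → τ ends))) ⟩
      τ ends + sumNST ends u ∎
      where
      open ≡-Reasoning
      ΣS : (Subset n → ℕ) → ℕ
      ΣS = sumOver (allSubsets n)
      ΣF : (Subset m → ℕ) → ℕ
      ΣF = sumOver (allSubsets m)
      nonSpanning : Subset n → Subset m → ℕ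
      nonSpanning S F = if isTree ends S F ∧ lookup S u ∧ proper ends S then prodDegOutside ends S else 0

-- Imported only here: the prefix +_ of ℤ would make the ℕ sections (x +_) above ambiguous.
open import Data.Integer using (+_; _-_; _⊖_)
open import Data.Integer.Properties using (m-n≡m⊖n; ⊖-≥)

theorem2 : (n m : ℕ) (ends : Fin m → Fin n × Fin n) → Loopless ends →
    (u : Fin n) →
    + τ ends ≡ + prodDegExcept ends u - + sumNST ends u
theorem2 n m ends loopless u = begin
  + τ ends                                  ≡⟨ cong +_ (sym (m+n∸n≡m (τ ends) s)) ⟩
  + (τ ends + s ∸ s)                        ≡⟨ sym (⊖-≥ (m≤n+m s (τ ends))) ⟩
  (τ ends + s) ⊖ s                          ≡⟨ sym (m-n≡m⊖n (τ ends + s) s) ⟩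
  + (τ ends + s) - + s                      ≡⟨ cong (λ k → + k - + s) (sym (prodDegExcept≡τ+sumNST ends loopless u)) ⟩
  + prodDegExcept ends u - + sumNST ends u  ∎
  where
  open ≡-Reasoning
  s : ℕ
  s = sumNST ends u
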